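{- Let $n,t$ be positive integers. The number of triples $(\alpha,\beta,\gamma)$ of partitions with $|\alpha|+|\beta|+|\gamma|=n$, where $\alpha$ is a $2$-distinct partition of length $t$, $\beta$ is a strict partition of length $t$ and $\gamma$ is a partition of length exactly $t$, equals the number of Schmidt $3$-partitions of $n$ with $3t$ parts. The number of such triples in which instead $\gamma$ is a partition of length less than $t$ equals the number of Schmidt $3$-partitions of $n$ with $3t-1$ parts.
   Context: A partition is a finite weakly decreasing sequence of positive integers; its length is the number of parts and its weight $|\cdot|$ is the sum of the parts (the empty partition has length $0$ and weight $0$). A partition is $k$-distinct if any two adjacent parts differ by at least $k$; $1$-distinct partitions are called strict. A Schmidt $3$-partition of $n$ is a partition $(\lambda_1,\lambda_2,\ldots)$ with $\lambda_1>\lambda_2>\cdots$ and $\lambda_1+\lambda_4+\lambda_7+\cdots=n$. -}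

module Defs where

open import Data.Nat using (ℕ; zero; suc; _+_; _*_; _∸_; _≤_; _<_; _≥_; _>_)
open import Data.List using (List; []; _∷_; length)
open import Data.Nat.ListAction using (sum)
open import Data.List.Relation.Unary.All using (All)
open import Data.List.Relation.Unary.Linked using (Linked)
open import Data.Product using (Σ; _×_; _,_)
open import Relation.Binary.PropositionalEquality using (_≡_)

IsPartition : List ℕ → Set
IsPartition l = All (λ x → 0 < x) l × Linked _≥_ l

weight : List ℕ → ℕ
weight = sum

KDistinct : ℕ → List ℕ → Set
KDistinct k l = Linked (λ a b → b + k ≤ a) l

Strict : List ℕ → Set
Strict = KDistinct 1

every3 : List ℕ → ℕ
every3 [] = 0
every3 (x ∷ []) = x
every3 (x ∷ y ∷ []) = x
every3 (x ∷ y ∷ z ∷ xs) = x + every3 xs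

Schmidt3 : ℕ → ℕ → Set
Schmidt3 n m = Σ (List ℕ) λ l →
  IsPartition l × Linked _>_ l × every3 l ≡ n × length l ≡ m

Triples : ℕ → ℕ → (ℕ → Set) → Set
Triples n t P = Σ (List ℕ × List ℕ × List ℕ) λ where
  (α , β , γ) →
    (weight α + weight β + weight γ ≡ n)
    × (IsPartition α × KDistinct 2 α × length α ≡ t)
    × (IsPartition β × Strict β × length β ≡ t)
    × (IsPartition γ × P (length γ))

{-# OPTIONS --safe #-}

-- A triple (α, β, γ) with t parts each (γ padded by zeros) is sent to the partition whose
-- i-th block of three parts is
--   αᵢ + βᵢ + γᵢ,   (αᵢ₊₁ + 1) + βᵢ + γᵢ,   (αᵢ₊₁ + 1) + βᵢ₊₁ + γᵢ,
-- where αₜ₊₁ + 1 and βₜ₊₁ read as 0. Since α is 2-distinct, β strict and γ weakly decreasing,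
-- these 3t numbers strictly decrease, and every third one sums to |α| + |β| + |γ|. Only the very
-- last one can vanish, namely when γₜ = 0, i.e. when γ has fewer than t parts; dropping it leaves
-- 3t − 1 parts. Reading the blocks from the back, γᵢ, βᵢ and αᵢ are recovered by subtraction, so
-- the map is a bijection. Both sides are finite because every part of a Schmidt partition of n
-- is at most its first part, hence at most n.
module Submission where

open import Defs
open import Data.Empty using (⊥-elim)
open import Data.Fin as Fin using (Fin; toℕ; fromℕ<)
open import Data.Fin.Properties using (toℕ<n; toℕ-fromℕ<; fromℕ<-toℕ; +↔⊎; *↔×)
open import Data.List using (List; []; _∷_; length; drop)
open import Data.List.Relation.Unary.All as All using (All; []; _∷_; all?)
open import Data.List.Relation.Unary.Linked as Linked using (Linked; []; [-]; _∷_; linked?)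
open import Data.Nat using (ℕ; zero; suc; _+_; _*_; _∸_; _≤_; _<_; _≥_; _>_; z≤n; s≤s; z<s)
open import Data.Nat.ListAction using (sum)
open import Data.Nat.Properties
open import Algebra.Properties.CommutativeSemigroup +-commutativeSemigroup using (xy∙z≈xz∙y)
open import Data.Nat.Tactic.RingSolver using (solve-∀)
open import Data.Product using (Σ; _×_; _,_; proj₁; proj₂; ∃-syntax)
open import Data.Product.Function.Dependent.Propositional using (Σ-↔)
open import Data.Product.Function.NonDependent.Propositional using (_×-↔_)
open import Data.Sum using (_⊎_; inj₁; inj₂)
open import Data.Sum.Function.Propositional using (_⊎-↔_)
open import Function using (_∘_; case_of_)
open import Function.Bundles using (_↔_; _⇔_; mk↔ₛ′; mk⇔; Inverse; Equivalence)
open import Function.Construct.Composition using (_↔-∘_)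
open import Function.Construct.Identity using (↔-id)
open import Function.Construct.Symmetry using (↔-sym)
open import Relation.Binary.PropositionalEquality
open import Relation.Nullary using (Dec; yes; no; Irrelevant)
open import Relation.Nullary.Decidable using (_×-dec_)

-- Finite types

Finite : Set → Set
Finite A = ∃[ k ] (A ↔ Fin k)

Σ-≡ : {A : Set} {B : A → Set} → (∀ x → Irrelevant (B x)) →
      {a₁ a₂ : A} {b₁ : B a₁} {b₂ : B a₂} → a₁ ≡ a₂ → (a₁ , b₁) ≡ (a₂ , b₂)
Σ-≡ irr {b₁ = b₁} {b₂} refl = cong (_ ,_) (irr _ b₁ b₂)

×-irrelevant : {A B : Set} → Irrelevant A → Irrelevant B → Irrelevant (A × B)
×-irrelevant irrA irrB (a₁ , b₁) (a₂ , b₂) = cong₂ _,_ (irrA a₁ a₂) (irrB b₁ b₂)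

↔-finite : {A B : Set} → A ↔ B → Finite B → Finite A
↔-finite A↔B (k , B↔k) = k , B↔k ↔-∘ A↔B

Dec-finite : {P : Set} → Dec P → Irrelevant P → Finite P
Dec-finite (yes p) irr = 1 , mk↔ₛ′ (λ _ → Fin.zero) (λ _ → p) (λ { Fin.zero → refl ; (Fin.suc ()) }) (irr p)
Dec-finite (no ¬p) irr = 0 , mk↔ₛ′ (⊥-elim ∘ ¬p) (λ ()) (λ ()) (⊥-elim ∘ ¬p)

⊎-finite : {A B : Set} → Finite A → Finite B → Finite (A ⊎ B)
⊎-finite (k , A↔k) (l , B↔l) = k + l , ↔-sym +↔⊎ ↔-∘ (A↔k ⊎-↔ B↔l)

×-finite : {A B : Set} → Finite A → Finite B → Finite (A × B)
×-finite (k , A↔k) (l , B↔l) = k * l , ↔-sym *↔× ↔-∘ (A↔k ×-↔ B↔l)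

Σ-Fin-suc : {k : ℕ} {P : Fin (suc k) → Set} → Σ (Fin (suc k)) P ↔ (P Fin.zero ⊎ Σ (Fin k) (P ∘ Fin.suc))
Σ-Fin-suc {k} {P} =
  mk↔ₛ′ to from (λ { (inj₁ _) → refl ; (inj₂ _) → refl }) (λ { (Fin.zero , _) → refl ; (Fin.suc _ , _) → refl })
  where
    to : Σ (Fin (suc k)) P → P Fin.zero ⊎ Σ (Fin k) (P ∘ Fin.suc)
    to (Fin.zero , p) = inj₁ p
    to (Fin.suc i , p) = inj₂ (i , p)
    from : P Fin.zero ⊎ Σ (Fin k) (P ∘ Fin.suc) → Σ (Fin (suc k)) P
    from (inj₁ p) = Fin.zero , p
    from (inj₂ (i , p)) = Fin.suc i , p

Σ-Fin-finite : ∀ k {P : Fin k → Set} → (∀ i → Dec (P i)) → (∀ i → Irrelevant (P i)) → Finite (Σ (Fin k) P)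
Σ-Fin-finite zero _ _ = 0 , mk↔ₛ′ (λ { (() , _) }) (λ ()) (λ ()) (λ { (() , _) })
Σ-Fin-finite (suc k) P? irr =
  ↔-finite Σ-Fin-suc
    (⊎-finite (Dec-finite (P? Fin.zero) (irr Fin.zero)) (Σ-Fin-finite k (P? ∘ Fin.suc) (irr ∘ Fin.suc)))

Σ-finite : {A : Set} {P : A → Set} →
  Finite A → (∀ a → Dec (P a)) → (∀ a → Irrelevant (P a)) → Finite (Σ A P)
Σ-finite (k , A↔k) P? irr =
  ↔-finite (↔-sym (Σ-↔ (↔-sym A↔k) (↔-id _))) (Σ-Fin-finite k (P? ∘ from) (irr ∘ from))
  where open Inverse A↔k using (from)

BoundedList : ℕ → ℕ → Set
BoundedList n m = Σ (List ℕ) λ l → All (_≤ n) l × length l ≡ m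

BoundedList-suc : ∀ n m → BoundedList n (suc m) ↔ (Fin (suc n) × BoundedList n m)
BoundedList-suc n m = mk↔ₛ′ to from to∘from from∘to
  where
    to : BoundedList n (suc m) → Fin (suc n) × BoundedList n m
    to (x ∷ l , x≤n ∷ l≤n , e) = fromℕ< (s≤s x≤n) , (l , l≤n , suc-injective e)
    from : Fin (suc n) × BoundedList n m → BoundedList n (suc m)
    from (i , (l , l≤n , e)) = toℕ i ∷ l , ≤-pred (toℕ<n i) ∷ l≤n , cong suc e
    to∘from : ∀ y → to (from y) ≡ y
    to∘from (i , (l , l≤n , e)) = cong₂ _,_ (fromℕ<-toℕ i _) (cong (λ e′ → l , l≤n , e′) (≡-irrelevant _ _))
    from∘to : ∀ y → from (to y) ≡ y
    from∘to (x ∷ l , x≤n ∷ l≤n , e) =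
      Σ-≡ (λ _ → ×-irrelevant (All.irrelevant ≤-irrelevant) ≡-irrelevant) (cong (_∷ l) (toℕ-fromℕ< (s≤s x≤n)))

BoundedList-finite : ∀ n m → Finite (BoundedList n m)
BoundedList-finite n zero =
  1 , mk↔ₛ′ (λ _ → Fin.zero) (λ _ → [] , [] , refl)
          (λ { Fin.zero → refl ; (Fin.suc ()) }) (λ { ([] , [] , refl) → refl })
BoundedList-finite n (suc m) =
  ↔-finite (BoundedList-suc n m) (×-finite (suc n , ↔-id _) (BoundedList-finite n m))

IsPartition-irrelevant : ∀ l → Irrelevant (IsPartition l)
IsPartition-irrelevant l = ×-irrelevant (All.irrelevant ≤-irrelevant) (Linked.irrelevant ≤-irrelevant)

IsSchmidt3 : ℕ → List ℕ → Set
IsSchmidt3 n l = IsPartition l × Linked _>_ l × every3 l ≡ n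

IsSchmidt3? : ∀ n l → Dec (IsSchmidt3 n l)
IsSchmidt3? n l =
  (all? (0 <?_) l ×-dec linked? (λ x y → y ≤? x) l) ×-dec linked? (λ x y → y <? x) l ×-dec every3 l ≟ n

IsSchmidt3-irrelevant : ∀ n l → Irrelevant (IsSchmidt3 n l)
IsSchmidt3-irrelevant n l =
  ×-irrelevant (IsPartition-irrelevant l) (×-irrelevant (Linked.irrelevant ≤-irrelevant) ≡-irrelevant)

Schmidt3-irrelevant : ∀ n m l → Irrelevant (IsPartition l × Linked _>_ l × every3 l ≡ n × length l ≡ m)
Schmidt3-irrelevant n m l =
  ×-irrelevant (IsPartition-irrelevant l)
    (×-irrelevant (Linked.irrelevant ≤-irrelevant) (×-irrelevant ≡-irrelevant ≡-irrelevant))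

head≤every3 : ∀ x l → x ≤ every3 (x ∷ l)
head≤every3 x [] = ≤-refl
head≤every3 x (_ ∷ []) = ≤-refl
head≤every3 x (_ ∷ _ ∷ l) = m≤m+n x _

decreasing⇒bounded-by-head : ∀ {x l} → Linked _≥_ (x ∷ l) → All (_≤ x) (x ∷ l)
decreasing⇒bounded-by-head {l = []} _ = ≤-refl ∷ []
decreasing⇒bounded-by-head {l = _ ∷ _} (y≤x ∷ decreasing) =
  ≤-refl ∷ All.map (λ z≤y → ≤-trans z≤y y≤x) (decreasing⇒bounded-by-head decreasing)

IsSchmidt3⇒bounded : ∀ {n l} → IsSchmidt3 n l → All (_≤ n) l
IsSchmidt3⇒bounded {l = []} _ = []
IsSchmidt3⇒bounded {l = x ∷ l} ((_ , decreasing) , _ , refl) =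
  All.map (λ y≤x → ≤-trans y≤x (head≤every3 x l)) (decreasing⇒bounded-by-head decreasing)

Schmidt3↔bounded : ∀ n m → Schmidt3 n m ↔ Σ (BoundedList n m) (IsSchmidt3 n ∘ proj₁)
Schmidt3↔bounded n m = mk↔ₛ′ to from to∘from (λ _ → refl)
  where
    to : Schmidt3 n m → Σ (BoundedList n m) (IsSchmidt3 n ∘ proj₁)
    to (l , p , s , e , len) = (l , IsSchmidt3⇒bounded (p , s , e) , len) , (p , s , e)
    from : Σ (BoundedList n m) (IsSchmidt3 n ∘ proj₁) → Schmidt3 n m
    from ((l , _ , len) , (p , s , e)) = l , p , s , e , len
    to∘from : ∀ y → to (from y) ≡ y
    to∘from ((l , l≤n , len) , schmidt) =
      cong (λ l≤n′ → (l , l≤n′ , len) , schmidt) (All.irrelevant ≤-irrelevant _ l≤n)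

Schmidt3-finite : ∀ n m → Finite (Schmidt3 n m)
Schmidt3-finite n m =
  ↔-finite (Schmidt3↔bounded n m)
    (Σ-finite (BoundedList-finite n m) (IsSchmidt3? n ∘ proj₁) (IsSchmidt3-irrelevant n ∘ proj₁))

-- The bijection

Positive : List ℕ → Set
Positive = All (0 <_)

head₀ : List ℕ → ℕ
head₀ [] = 0
head₀ (x ∷ _) = x

sucHead : List ℕ → ℕ
sucHead [] = 0
sucHead (x ∷ _) = suc x

infixr 5 _∷⁺_
_∷⁺_ : ℕ → List ℕ → List ℕ
zero ∷⁺ l = l
suc x ∷⁺ l = suc x ∷ l

Triple : Set
Triple = List ℕ × List ℕ × List ℕ

toSchmidt : List ℕ → List ℕ → List ℕ → List ℕ
toSchmidt [] β γ = []
toSchmidt (a ∷ α) β γ =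
  a + head₀ β + head₀ γ ∷ sucHead α + head₀ β + head₀ γ ∷
  (sucHead α + head₀ (drop 1 β) + head₀ γ ∷⁺ toSchmidt α (drop 1 β) (drop 1 γ))

splitBlock : ℕ → ℕ → ℕ → Triple → Triple
splitBlock x₁ x₂ x₃ (α , β , γ) = x₁ ∸ (b + c) ∷ α , b ∷ β , c ∷⁺ γ
  where
    c b : ℕ
    c = x₃ ∸ (sucHead α + head₀ β)
    b = x₂ ∸ (sucHead α + c)

fromSchmidt : List ℕ → Triple
fromSchmidt [] = [] , [] , []
fromSchmidt (_ ∷ []) = [] , [] , []   -- junk: excluded by Blocks
fromSchmidt (x₁ ∷ x₂ ∷ []) = splitBlock x₁ x₂ 0 ([] , [] , [])
fromSchmidt (x₁ ∷ x₂ ∷ x₃ ∷ l) = splitBlock x₁ x₂ x₃ (fromSchmidt l)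

data Blocks : List ℕ → Set where
  empty  : Blocks []
  pair   : ∀ {x₁ x₂} → Blocks (x₁ ∷ x₂ ∷ [])
  triple : ∀ {x₁ x₂ x₃ l} → Blocks l → Blocks (x₁ ∷ x₂ ∷ x₃ ∷ l)

record Admissible (α β γ : List ℕ) : Set where
  constructor admissible
  field
    α-positive : Positive α
    α-2-distinct : KDistinct 2 α
    β-positive : Positive β
    β-strict : Strict β
    γ-partition : IsPartition γ
    β-length : length β ≡ length α
    γ-length : length γ ≤ length α

Decomposition : List ℕ → Triple → Set
Decomposition l (α , β , γ) = Admissible α β γ × toSchmidt α β γ ≡ l

sucHead<head : ∀ {a α} → Positive (a ∷ α) → KDistinct 2 (a ∷ α) → sucHead α < a
sucHead<head {α = []} (0<a ∷ _) _ = 0<a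
sucHead<head {a} {a′ ∷ _} _ (a′+2≤a ∷ _) = subst (_≤ a) (+-comm a′ 2) a′+2≤a

head₀<head : ∀ {b β} → Positive (b ∷ β) → Strict (b ∷ β) → head₀ β < b
head₀<head {β = []} (0<b ∷ _) _ = 0<b
head₀<head {b} {b′ ∷ _} _ (b′+1≤b ∷ _) = subst (_≤ b) (+-comm b′ 1) b′+1≤b

head₀-drop≤ : ∀ {γ} → Linked _≥_ γ → head₀ (drop 1 γ) ≤ head₀ γ
head₀-drop≤ [] = z≤n
head₀-drop≤ [-] = z≤n
head₀-drop≤ (c′≤c ∷ _) = c′≤c

head₀-∷⁺-drop : ∀ {γ} → Positive γ → head₀ γ ∷⁺ drop 1 γ ≡ γ
head₀-∷⁺-drop [] = refl
head₀-∷⁺-drop {suc _ ∷ _} _ = refl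

sum-head₀ : ∀ γ → sum γ ≡ head₀ γ + sum (drop 1 γ)
sum-head₀ [] = refl
sum-head₀ (_ ∷ _) = refl

admissible-tail : ∀ {a α b β γ} → Admissible (a ∷ α) (b ∷ β) γ → Admissible α β (drop 1 γ)
admissible-tail {γ = []} (admissible (_ ∷ α⁺) α₂ (_ ∷ β⁺) β₁ _ β-len _) =
  admissible α⁺ (Linked.tail α₂) β⁺ (Linked.tail β₁) ([] , []) (suc-injective β-len) z≤n
admissible-tail {γ = _ ∷ _} (admissible (_ ∷ α⁺) α₂ (_ ∷ β⁺) β₁ (_ ∷ γ⁺ , γ≥) β-len (s≤s γ-len)) =
  admissible α⁺ (Linked.tail α₂) β⁺ (Linked.tail β₁) (γ⁺ , Linked.tail γ≥) (suc-injective β-len) γ-len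

sucHead-toSchmidt : ∀ {α β γ} → Admissible α β γ → sucHead (toSchmidt α β γ) ≡ sucHead α + head₀ β + head₀ γ
sucHead-toSchmidt {[]} {[]} {[]} _ = refl
sucHead-toSchmidt {[]} {_ ∷ _} (admissible _ _ _ _ _ () _)
sucHead-toSchmidt {[]} {[]} {_ ∷ _} (admissible _ _ _ _ _ _ ())
sucHead-toSchmidt {_ ∷ _} _ = refl

sucHead-toSchmidt-tail≤ : ∀ {a α b β γ} → Admissible (a ∷ α) (b ∷ β) γ →
  sucHead (toSchmidt α β (drop 1 γ)) ≤ sucHead α + head₀ β + head₀ γ
sucHead-toSchmidt-tail≤ {α = α} {β = β} {γ} adm =
  subst (_≤ sucHead α + head₀ β + head₀ γ) (sym (sucHead-toSchmidt (admissible-tail adm)))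
    (+-monoʳ-≤ (sucHead α + head₀ β) (head₀-drop≤ (proj₂ (Admissible.γ-partition adm))))

every3-block : ∀ x₁ x₂ x₃ r → sucHead r ≤ x₃ → every3 (x₁ ∷ x₂ ∷ (x₃ ∷⁺ r)) ≡ x₁ + every3 r
every3-block x₁ x₂ zero [] _ = sym (+-identityʳ x₁)
every3-block x₁ x₂ (suc _) r _ = refl

fromSchmidt-block : ∀ x₁ x₂ x₃ r → sucHead r ≤ x₃ →
  fromSchmidt (x₁ ∷ x₂ ∷ (x₃ ∷⁺ r)) ≡ splitBlock x₁ x₂ x₃ (fromSchmidt r)
fromSchmidt-block x₁ x₂ zero [] _ = refl
fromSchmidt-block x₁ x₂ (suc _) r _ = refl

decreasing-block : ∀ {x₂ x₃ r} → x₃ < x₂ → sucHead r ≤ x₃ → Linked _>_ r →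
  Linked _>_ (x₂ ∷ (x₃ ∷⁺ r))
decreasing-block {x₃ = zero} {[]} _ _ _ = [-]
decreasing-block {x₃ = suc _} {[]} x₃<x₂ _ _ = x₃<x₂ ∷ [-]
decreasing-block {x₃ = suc _} {_ ∷ _} x₃<x₂ r<x₃ r> = x₃<x₂ ∷ r<x₃ ∷ r>

positive-∷⁺ : ∀ x {r} → Positive r → Positive (x ∷⁺ r)
positive-∷⁺ zero r⁺ = r⁺
positive-∷⁺ (suc _) r⁺ = z<s ∷ r⁺

toSchmidt-block-decreasing : ∀ {a α b β γ} → Admissible (a ∷ α) (b ∷ β) γ →
  sucHead α + b + head₀ γ < a + b + head₀ γ × sucHead α + head₀ β + head₀ γ < sucHead α + b + head₀ γ
toSchmidt-block-decreasing {α = α} {b} {γ = γ} (admissible α⁺ α₂ β⁺ β₁ _ _ _) =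
  +-monoˡ-< (head₀ γ) (+-monoˡ-< b (sucHead<head α⁺ α₂)) ,
  +-monoˡ-< (head₀ γ) (+-monoʳ-< (sucHead α) (head₀<head β⁺ β₁))

toSchmidt-positive : ∀ {α β γ} → Admissible α β γ → Positive (toSchmidt α β γ)
toSchmidt-positive {[]} _ = []
toSchmidt-positive {_ ∷ _} {[]} (admissible _ _ _ _ _ () _)
toSchmidt-positive {_ ∷ _} {_ ∷ _} adm =
  let (x₂<x₁ , x₃<x₂) = toSchmidt-block-decreasing adm
  in m<n⇒0<n x₂<x₁ ∷ m<n⇒0<n x₃<x₂ ∷ positive-∷⁺ _ (toSchmidt-positive (admissible-tail adm))

toSchmidt-decreasing : ∀ {α β γ} → Admissible α β γ → Linked _>_ (toSchmidt α β γ)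
toSchmidt-decreasing {[]} _ = []
toSchmidt-decreasing {_ ∷ _} {[]} (admissible _ _ _ _ _ () _)
toSchmidt-decreasing {_ ∷ _} {_ ∷ _} adm =
  let (x₂<x₁ , x₃<x₂) = toSchmidt-block-decreasing adm
  in x₂<x₁ ∷ decreasing-block x₃<x₂ (sucHead-toSchmidt-tail≤ adm) (toSchmidt-decreasing (admissible-tail adm))

every3-toSchmidt : ∀ {α β γ} → Admissible α β γ → every3 (toSchmidt α β γ) ≡ sum α + sum β + sum γ
every3-toSchmidt {[]} {[]} {[]} _ = refl
every3-toSchmidt {[]} {_ ∷ _} (admissible _ _ _ _ _ () _)
every3-toSchmidt {[]} {[]} {_ ∷ _} (admissible _ _ _ _ _ _ ())
every3-toSchmidt {_ ∷ _} {[]} (admissible _ _ _ _ _ () _)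
every3-toSchmidt {a ∷ α} {b ∷ β} {γ} adm = begin
  every3 (toSchmidt (a ∷ α) (b ∷ β) γ)
    ≡⟨ every3-block _ _ _ _ (sucHead-toSchmidt-tail≤ adm) ⟩
  a + b + head₀ γ + every3 (toSchmidt α β (drop 1 γ))
    ≡⟨ cong (a + b + head₀ γ +_) (every3-toSchmidt (admissible-tail adm)) ⟩
  a + b + head₀ γ + (sum α + sum β + sum (drop 1 γ))
    ≡⟨ regroup a b (head₀ γ) (sum α) (sum β) (sum (drop 1 γ)) ⟩
  a + sum α + (b + sum β) + (head₀ γ + sum (drop 1 γ))
    ≡⟨ cong (a + sum α + (b + sum β) +_) (sym (sum-head₀ γ)) ⟩
  a + sum α + (b + sum β) + sum γ ∎
  where
    open ≡-Reasoning
    regroup : ∀ a b c x y z → a + b + c + (x + y + z) ≡ a + x + (b + y) + (c + z)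
    regroup = solve-∀

splitBlock-≡ : ∀ {x₁ x₂ x₃ α β γ a b c} →
  x₃ ∸ (sucHead α + head₀ β) ≡ c → x₂ ∸ (sucHead α + c) ≡ b → x₁ ∸ (b + c) ≡ a →
  splitBlock x₁ x₂ x₃ (α , β , γ) ≡ (a ∷ α , b ∷ β , c ∷⁺ γ)
splitBlock-≡ refl refl refl = refl

[m+n+o]∸[m+o]≡n : ∀ m n o → m + n + o ∸ (m + o) ≡ n
[m+n+o]∸[m+o]≡n m n o = trans (cong (_∸ (m + o)) (xy∙z≈xz∙y m n o)) (m+n∸m≡n (m + o) n)

[m+n+o]∸[n+o]≡m : ∀ m n o → m + n + o ∸ (n + o) ≡ m
[m+n+o]∸[n+o]≡m m n o = trans (cong (_∸ (n + o)) (+-assoc m n o)) (m+n∸n≡m m (n + o))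

fromSchmidt-toSchmidt : ∀ {α β γ} → Admissible α β γ → fromSchmidt (toSchmidt α β γ) ≡ (α , β , γ)
fromSchmidt-toSchmidt {[]} {[]} {[]} _ = refl
fromSchmidt-toSchmidt {[]} {_ ∷ _} (admissible _ _ _ _ _ () _)
fromSchmidt-toSchmidt {[]} {[]} {_ ∷ _} (admissible _ _ _ _ _ _ ())
fromSchmidt-toSchmidt {_ ∷ _} {[]} (admissible _ _ _ _ _ () _)
fromSchmidt-toSchmidt {a ∷ α} {b ∷ β} {γ} adm = begin
  fromSchmidt (x₁ ∷ x₂ ∷ (x₃ ∷⁺ toSchmidt α β (drop 1 γ)))
    ≡⟨ fromSchmidt-block x₁ x₂ x₃ _ (sucHead-toSchmidt-tail≤ adm) ⟩
  splitBlock x₁ x₂ x₃ (fromSchmidt (toSchmidt α β (drop 1 γ)))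
    ≡⟨ cong (splitBlock x₁ x₂ x₃) (fromSchmidt-toSchmidt (admissible-tail adm)) ⟩
  splitBlock x₁ x₂ x₃ (α , β , drop 1 γ)
    ≡⟨ splitBlock-≡ (m+n∸m≡n (sucHead α + head₀ β) (head₀ γ))
                    ([m+n+o]∸[m+o]≡n (sucHead α) b (head₀ γ))
                    ([m+n+o]∸[n+o]≡m a b (head₀ γ)) ⟩
  (a ∷ α , b ∷ β , head₀ γ ∷⁺ drop 1 γ)
    ≡⟨ cong (λ γ′ → a ∷ α , b ∷ β , γ′) (head₀-∷⁺-drop (proj₁ (Admissible.γ-partition adm))) ⟩
  (a ∷ α , b ∷ β , γ) ∎
  where
    open ≡-Reasoning
    x₁ x₂ x₃ : ℕ
    x₁ = a + b + head₀ γ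
    x₂ = sucHead α + b + head₀ γ
    x₃ = sucHead α + head₀ β + head₀ γ

2-distinct-∷ : ∀ {a α} → sucHead α < a → KDistinct 2 α → KDistinct 2 (a ∷ α)
2-distinct-∷ {α = []} _ _ = [-]
2-distinct-∷ {a} {a′ ∷ _} a′+2≤a α₂ = subst (_≤ a) (+-comm 2 a′) a′+2≤a ∷ α₂

strict-∷ : ∀ {b β} → head₀ β < b → Strict β → Strict (b ∷ β)
strict-∷ {β = []} _ _ = [-]
strict-∷ {b} {b′ ∷ _} b′+1≤b β₁ = subst (_≤ b) (+-comm 1 b′) b′+1≤b ∷ β₁

decreasing-∷⁺ : ∀ {c γ} → head₀ γ ≤ c → Linked _≥_ γ → Linked _≥_ (c ∷⁺ γ)
decreasing-∷⁺ {zero} _ γ≥ = γ≥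
decreasing-∷⁺ {suc _} {[]} _ _ = [-]
decreasing-∷⁺ {suc _} {_ ∷ _} γ≤c γ≥ = γ≤c ∷ γ≥

length-∷⁺≤ : ∀ c γ → length (c ∷⁺ γ) ≤ suc (length γ)
length-∷⁺≤ zero γ = n≤1+n (length γ)
length-∷⁺≤ (suc _) γ = ≤-refl

head₀-∷⁺ : ∀ {c γ} → Positive γ → head₀ γ ≤ c → head₀ (c ∷⁺ γ) ≡ c
head₀-∷⁺ {zero} {[]} _ _ = refl
head₀-∷⁺ {zero} {_ ∷ _} (s≤s z≤n ∷ _) ()
head₀-∷⁺ {suc _} _ _ = refl

drop-∷⁺ : ∀ {c γ} → Positive γ → head₀ γ ≤ c → drop 1 (c ∷⁺ γ) ≡ γ
drop-∷⁺ {zero} {[]} _ _ = refl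
drop-∷⁺ {zero} {_ ∷ _} (s≤s z≤n ∷ _) ()
drop-∷⁺ {suc _} _ _ = refl

sucHead≤head : ∀ {x l} → Linked _>_ (x ∷ l) → sucHead l ≤ x
sucHead≤head [-] = z≤n
sucHead≤head (x>y ∷ _) = x>y

admissible-cons : ∀ {α β γ a b c} → Admissible α β γ →
  sucHead α < a → head₀ β < b → head₀ γ ≤ c → Admissible (a ∷ α) (b ∷ β) (c ∷⁺ γ)
admissible-cons {γ = γ} {c = c} (admissible α⁺ α₂ β⁺ β₁ (γ⁺ , γ≥) β-len γ-len) α<a β<b γ≤c =
  admissible (m<n⇒0<n α<a ∷ α⁺) (2-distinct-∷ α<a α₂) (m<n⇒0<n β<b ∷ β⁺) (strict-∷ β<b β₁)
    (positive-∷⁺ c γ⁺ , decreasing-∷⁺ γ≤c γ≥) (cong suc β-len) (≤-trans (length-∷⁺≤ c γ) (s≤s γ-len))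

decomposition-cons : ∀ {x₁ x₂ x₃ r α β γ a b c} → Decomposition r (α , β , γ) →
  x₂ < x₁ → x₃ < x₂ → sucHead r ≤ x₃ →
  a + b + c ≡ x₁ → sucHead α + b + c ≡ x₂ → sucHead α + head₀ β + c ≡ x₃ →
  Decomposition (x₁ ∷ x₂ ∷ (x₃ ∷⁺ r)) (a ∷ α , b ∷ β , c ∷⁺ γ)
decomposition-cons {α = α} {β} {γ} {a} {b} {c} (adm , refl) x₂<x₁ x₃<x₂ r≤x₃ refl refl refl =
  admissible-cons adm α<a β<b γ≤c , toSchmidt-cons
  where
    γ⁺ : Positive γ
    γ⁺ = proj₁ (Admissible.γ-partition adm)
    γ≤c : head₀ γ ≤ c
    γ≤c = +-cancelˡ-≤ (sucHead α + head₀ β) _ _ (subst (_≤ _) (sucHead-toSchmidt adm) r≤x₃)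
    β<b : head₀ β < b
    β<b = +-cancelˡ-< (sucHead α) _ _ (+-cancelʳ-< c _ _ x₃<x₂)
    α<a : sucHead α < a
    α<a = +-cancelʳ-< b _ _ (+-cancelʳ-< c _ _ x₂<x₁)
    toSchmidt-cons : toSchmidt (a ∷ α) (b ∷ β) (c ∷⁺ γ) ≡
                     a + b + c ∷ sucHead α + b + c ∷ (sucHead α + head₀ β + c ∷⁺ toSchmidt α β γ)
    toSchmidt-cons rewrite head₀-∷⁺ γ⁺ γ≤c | drop-∷⁺ γ⁺ γ≤c = refl

decomposition-block : ∀ {x₁ x₂ x₃ r t} → Decomposition r t → x₂ < x₁ → x₃ < x₂ → sucHead r ≤ x₃ →
  Decomposition (x₁ ∷ x₂ ∷ (x₃ ∷⁺ r)) (splitBlock x₁ x₂ x₃ t)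
decomposition-block {x₁} {x₂} {x₃} {t = α , β , γ} (adm , refl) x₂<x₁ x₃<x₂ r≤x₃ =
  decomposition-cons (adm , refl) x₂<x₁ x₃<x₂ r≤x₃ (trans (+-assoc a b c) (m∸n+n≡m bc≤x₁)) αbc≡x₂ αβc≡x₃
  where
    open ≤-Reasoning
    c b a : ℕ
    c = x₃ ∸ (sucHead α + head₀ β)
    b = x₂ ∸ (sucHead α + c)
    a = x₁ ∸ (b + c)
    αβ≤x₃ : sucHead α + head₀ β ≤ x₃
    αβ≤x₃ = begin
      sucHead α + head₀ β                   ≤⟨ m≤m+n _ (head₀ γ) ⟩
      sucHead α + head₀ β + head₀ γ         ≡⟨ sucHead-toSchmidt adm ⟨
      sucHead (toSchmidt α β γ)             ≤⟨ r≤x₃ ⟩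
      x₃                                    ∎
    αβc≡x₃ : sucHead α + head₀ β + c ≡ x₃
    αβc≡x₃ = m+[n∸m]≡n αβ≤x₃
    αc≤x₂ : sucHead α + c ≤ x₂
    αc≤x₂ = begin
      sucHead α + c                         ≤⟨ +-monoˡ-≤ c (m≤m+n (sucHead α) (head₀ β)) ⟩
      sucHead α + head₀ β + c               ≡⟨ αβc≡x₃ ⟩
      x₃                                    <⟨ x₃<x₂ ⟩
      x₂                                    ∎
    αbc≡x₂ : sucHead α + b + c ≡ x₂
    αbc≡x₂ = trans (xy∙z≈xz∙y (sucHead α) b c) (m+[n∸m]≡n αc≤x₂)
    bc≤x₁ : b + c ≤ x₁
    bc≤x₁ = begin
      b + c                                 ≤⟨ m≤n+m (b + c) (sucHead α) ⟩
      sucHead α + (b + c)                   ≡⟨ +-assoc (sucHead α) b c ⟨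
      sucHead α + b + c                     ≡⟨ αbc≡x₂ ⟩
      x₂                                    <⟨ x₂<x₁ ⟩
      x₁                                    ∎

fromSchmidt-decomposes : ∀ {l} → Blocks l → Positive l → Linked _>_ l → Decomposition l (fromSchmidt l)
fromSchmidt-decomposes empty _ _ = admissible [] [] [] [] ([] , []) refl z≤n , refl
fromSchmidt-decomposes pair (_ ∷ 0<x₂ ∷ []) (x₂<x₁ ∷ _) =
  decomposition-block (fromSchmidt-decomposes empty [] []) x₂<x₁ 0<x₂ z≤n
fromSchmidt-decomposes (triple {x₃ = zero} _) (_ ∷ _ ∷ () ∷ _) _
fromSchmidt-decomposes (triple {x₃ = suc _} blocks) (_ ∷ _ ∷ _ ∷ l⁺) (x₂<x₁ ∷ x₃<x₂ ∷ x₃∷l>) =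
  decomposition-block (fromSchmidt-decomposes blocks l⁺ (Linked.tail x₃∷l>)) x₂<x₁ x₃<x₂ (sucHead≤head x₃∷l>)

KDistinct⇒decreasing : ∀ {k l} → KDistinct k l → Linked _≥_ l
KDistinct⇒decreasing {k} = Linked.map (λ {_} {b} b+k≤a → ≤-trans (m≤m+n b k) b+k≤a)

TripleConditions : ℕ → ℕ → (ℕ → Set) → Triple → Set
TripleConditions n t P (α , β , γ) =
    (weight α + weight β + weight γ ≡ n)
    × (IsPartition α × KDistinct 2 α × length α ≡ t)
    × (IsPartition β × Strict β × length β ≡ t)
    × (IsPartition γ × P (length γ))

TripleConditions-irrelevant : ∀ {n t P} → (∀ ℓ → Irrelevant (P ℓ)) → ∀ x → Irrelevant (TripleConditions n t P x)
TripleConditions-irrelevant P-irr (α , β , γ) =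
  ×-irrelevant ≡-irrelevant
    (×-irrelevant (×-irrelevant (IsPartition-irrelevant α) (×-irrelevant (Linked.irrelevant ≤-irrelevant) ≡-irrelevant))
      (×-irrelevant (×-irrelevant (IsPartition-irrelevant β) (×-irrelevant (Linked.irrelevant ≤-irrelevant) ≡-irrelevant))
        (×-irrelevant (IsPartition-irrelevant γ) (P-irr (length γ)))))

Triples↔Schmidt3 : ∀ n t m (P : ℕ → Set) → (∀ ℓ → Irrelevant (P ℓ)) → (∀ {ℓ} → P ℓ → ℓ ≤ t) →
  (∀ {l : List ℕ} → length l ≡ m → Blocks l) →
  (∀ {α β γ} → Admissible α β γ → (length α ≡ t × P (length γ)) ⇔ (length (toSchmidt α β γ) ≡ m)) →
  Triples n t P ↔ Schmidt3 n m
Triples↔Schmidt3 n t m P P-irr P⇒≤t blocks length-⇔ = mk↔ₛ′ to from to∘from from∘to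
  where
    conditions⇒admissible : ∀ {α β γ} → TripleConditions n t P (α , β , γ) → Admissible α β γ
    conditions⇒admissible {γ = γ} (_ , ((α⁺ , _) , α₂ , α-len) , ((β⁺ , _) , β₁ , β-len) , (γ-partition , Pγ)) =
      admissible α⁺ α₂ β⁺ β₁ γ-partition (trans β-len (sym α-len)) (subst (length γ ≤_) (sym α-len) (P⇒≤t Pγ))

    decomposition⇒conditions : ∀ {l α β γ} → Decomposition l (α , β , γ) → every3 l ≡ n → length l ≡ m →
      TripleConditions n t P (α , β , γ)
    decomposition⇒conditions (adm@(admissible α⁺ α₂ β⁺ β₁ γ-partition β-len _) , refl) every3≡ l-len =
      let (α-len , Pγ) = Equivalence.from (length-⇔ adm) l-len in
      trans (sym (every3-toSchmidt adm)) every3≡ ,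
      ((α⁺ , KDistinct⇒decreasing α₂) , α₂ , α-len) ,
      ((β⁺ , KDistinct⇒decreasing β₁) , β₁ , trans β-len α-len) ,
      (γ-partition , Pγ)

    decomposes : ((l , _) : Schmidt3 n m) → Decomposition l (fromSchmidt l)
    decomposes (l , (l⁺ , _) , l> , _ , l-len) = fromSchmidt-decomposes (blocks l-len) l⁺ l>

    to : Triples n t P → Schmidt3 n m
    to ((α , β , γ) , conditions@(weight≡ , (_ , _ , α-len) , _ , (_ , Pγ))) =
      toSchmidt α β γ , (toSchmidt-positive adm , Linked.map <⇒≤ (toSchmidt-decreasing adm)) ,
      toSchmidt-decreasing adm , trans (every3-toSchmidt adm) weight≡ , Equivalence.to (length-⇔ adm) (α-len , Pγ)
      where
        adm : Admissible α β γ
        adm = conditions⇒admissible conditions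

    from : Schmidt3 n m → Triples n t P
    from s@(l , _ , _ , every3≡ , l-len) = fromSchmidt l , decomposition⇒conditions (decomposes s) every3≡ l-len

    to∘from : ∀ s → to (from s) ≡ s
    to∘from s = Σ-≡ (Schmidt3-irrelevant n m) (proj₂ (decomposes s))

    from∘to : ∀ x → from (to x) ≡ x
    from∘to (_ , conditions) =
      Σ-≡ (TripleConditions-irrelevant P-irr) (fromSchmidt-toSchmidt (conditions⇒admissible conditions))

-- Numbers of parts

length-drop-1≤ : ∀ {n} (γ : List ℕ) → length γ ≤ suc n → length (drop 1 γ) ≤ n
length-drop-1≤ [] _ = z≤n
length-drop-1≤ (_ ∷ _) (s≤s γ≤n) = γ≤n

length-toSchmidt : ∀ {α β γ} → Admissible α β γ → length γ ≡ length α →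
  length (toSchmidt α β γ) ≡ 3 * length α
length-toSchmidt {[]} {[]} {[]} _ _ = refl
length-toSchmidt {[]} {_ ∷ _} (admissible _ _ _ _ _ () _) _
length-toSchmidt {[]} {[]} {_ ∷ _} _ ()
length-toSchmidt {_ ∷ _} {[]} (admissible _ _ _ _ _ () _) _
length-toSchmidt {_ ∷ []} {_ ∷ _ ∷ _} (admissible _ _ _ _ _ () _) _
length-toSchmidt {_ ∷ []} {_ ∷ []} {[]} _ ()
length-toSchmidt {_ ∷ []} {_ ∷ []} {zero ∷ []} (admissible _ _ _ _ (() ∷ _ , _) _ _) _
length-toSchmidt {_ ∷ []} {_ ∷ []} {suc _ ∷ []} _ _ = refl
length-toSchmidt {_ ∷ []} {_ ∷ []} {_ ∷ _ ∷ _} _ ()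
length-toSchmidt {_ ∷ _ ∷ _} {_ ∷ _} {[]} _ ()
length-toSchmidt {_ ∷ α@(_ ∷ _)} {_ ∷ _} {_ ∷ _} adm γ-len =
  trans (cong (3 +_) (length-toSchmidt (admissible-tail adm) (suc-injective γ-len))) (sym (*-suc 3 (length α)))

length-toSchmidt-short : ∀ {α β γ} → Admissible α β γ → length γ < length α →
  suc (length (toSchmidt α β γ)) ≡ 3 * length α
length-toSchmidt-short {_ ∷ []} {_ ∷ []} {[]} _ _ = refl
length-toSchmidt-short {_ ∷ []} {_ ∷ []} {_ ∷ _} _ (s≤s ())
length-toSchmidt-short {_ ∷ []} {_ ∷ _ ∷ _} (admissible _ _ _ _ _ () _) _
length-toSchmidt-short {_ ∷ _} {[]} (admissible _ _ _ _ _ () _) _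
length-toSchmidt-short {_ ∷ α@(_ ∷ _)} {_ ∷ _} {γ} adm γ<α =
  trans (cong (3 +_) (length-toSchmidt-short (admissible-tail adm) (s≤s (length-drop-1≤ γ (≤-pred γ<α)))))
        (sym (*-suc 3 (length α)))

length-toSchmidt-cases : ∀ {α β γ} → Admissible α β γ →
  (length γ ≡ length α × length (toSchmidt α β γ) ≡ 3 * length α) ⊎
  (length γ < length α × suc (length (toSchmidt α β γ)) ≡ 3 * length α)
length-toSchmidt-cases adm with m≤n⇒m<n∨m≡n (Admissible.γ-length adm)
... | inj₁ γ<α = inj₂ (γ<α , length-toSchmidt-short adm γ<α)
... | inj₂ γ≡α = inj₁ (γ≡α , length-toSchmidt adm γ≡α)

3*m≢1+3*n : ∀ m n → 3 * m ≢ suc (3 * n)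
3*m≢1+3*n zero n ()
3*m≢1+3*n (suc m) zero e = case trans (sym (*-suc 3 m)) e of λ ()
3*m≢1+3*n (suc m) (suc n) e =
  3*m≢1+3*n m n (cong (_∸ 3) (trans (sym (*-suc 3 m)) (trans e (cong suc (*-suc 3 n)))))

blocks-3* : ∀ t {l : List ℕ} → length l ≡ 3 * t → Blocks l
blocks-3* zero {[]} _ = empty
blocks-3* (suc t) {_ ∷ _ ∷ _ ∷ _} e = triple (blocks-3* t (cong (_∸ 3) (trans e (*-suc 3 t))))
blocks-3* (suc t) {[]} e = case trans e (*-suc 3 t) of λ ()
blocks-3* (suc t) {_ ∷ []} e = case trans e (*-suc 3 t) of λ ()
blocks-3* (suc t) {_ ∷ _ ∷ []} e = case trans e (*-suc 3 t) of λ ()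

blocks-3*-1 : ∀ t {l : List ℕ} → suc (length l) ≡ 3 * suc t → Blocks l
blocks-3*-1 zero {_ ∷ _ ∷ []} _ = pair
blocks-3*-1 (suc t) {_ ∷ _ ∷ _ ∷ _} e = triple (blocks-3*-1 t (cong (_∸ 3) (trans e (*-suc 3 (suc t)))))
blocks-3*-1 zero {[]} ()
blocks-3*-1 zero {_ ∷ []} ()
blocks-3*-1 zero {_ ∷ _ ∷ _ ∷ _} ()
blocks-3*-1 (suc t) {[]} e = case trans e (*-suc 3 (suc t)) of λ ()
blocks-3*-1 (suc t) {_ ∷ []} e = case trans e (*-suc 3 (suc t)) of λ ()
blocks-3*-1 (suc t) {_ ∷ _ ∷ []} e = case trans e (*-suc 3 (suc t)) of λ ()

Triples-full↔Schmidt3 : ∀ n t → Triples n t (_≡ t) ↔ Schmidt3 n (3 * t)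
Triples-full↔Schmidt3 n t =
  Triples↔Schmidt3 n t (3 * t) (_≡ t) (λ _ → ≡-irrelevant) ≤-reflexive (blocks-3* t) length-⇔
  where
    length-⇔ : ∀ {α β γ} → Admissible α β γ → (length α ≡ t × length γ ≡ t) ⇔ (length (toSchmidt α β γ) ≡ 3 * t)
    length-⇔ {α} {β} {γ} adm = mk⇔ to from
      where
        to : length α ≡ t × length γ ≡ t → length (toSchmidt α β γ) ≡ 3 * t
        to (α-len , γ-len) = trans (length-toSchmidt adm (trans γ-len (sym α-len))) (cong (3 *_) α-len)
        from : length (toSchmidt α β γ) ≡ 3 * t → length α ≡ t × length γ ≡ t
        from φ-len with length-toSchmidt-cases adm
        ... | inj₁ (γ≡α , φ≡) = let α≡t = *-cancelˡ-≡ _ _ 3 (trans (sym φ≡) φ-len) in α≡t , trans γ≡α α≡t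
        ... | inj₂ (_ , φ≡) = ⊥-elim (3*m≢1+3*n (length α) t (trans (sym φ≡) (cong suc φ-len)))

-- suc (3 * suc t ∸ 1) and 3 * suc t are equal by computation, which the length bookkeeping uses.
Triples-short↔Schmidt3 : ∀ n t → Triples n (suc t) (_< suc t) ↔ Schmidt3 n (3 * suc t ∸ 1)
Triples-short↔Schmidt3 n t =
  Triples↔Schmidt3 n (suc t) (3 * suc t ∸ 1) (_< suc t) (λ _ → ≤-irrelevant) <⇒≤
    (blocks-3*-1 t ∘ cong suc) length-⇔
  where
    length-⇔ : ∀ {α β γ} → Admissible α β γ →
      (length α ≡ suc t × length γ < suc t) ⇔ (length (toSchmidt α β γ) ≡ 3 * suc t ∸ 1)
    length-⇔ {α} {β} {γ} adm = mk⇔ to from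
      where
        to : length α ≡ suc t × length γ < suc t → length (toSchmidt α β γ) ≡ 3 * suc t ∸ 1
        to (α-len , γ<t) =
          suc-injective (trans (length-toSchmidt-short adm (subst (length γ <_) (sym α-len) γ<t)) (cong (3 *_) α-len))
        from : length (toSchmidt α β γ) ≡ 3 * suc t ∸ 1 → length α ≡ suc t × length γ < suc t
        from φ-len with length-toSchmidt-cases adm
        ... | inj₁ (_ , φ≡) = ⊥-elim (3*m≢1+3*n (suc t) (length α) (trans (cong suc (sym φ-len)) (cong suc φ≡)))
        ... | inj₂ (γ<α , φ≡) =
          let α≡t = *-cancelˡ-≡ _ _ 3 (trans (sym φ≡) (cong suc φ-len)) in α≡t , subst (length γ <_) α≡t γ<α

Schmidt3-equinumerous : ∀ {A : Set} {n m} → A ↔ Schmidt3 n m → ∃[ k ] ((A ↔ Fin k) × (Schmidt3 n m ↔ Fin k))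
Schmidt3-equinumerous A↔S = let (k , S↔k) = Schmidt3-finite _ _ in k , S↔k ↔-∘ A↔S , S↔k

corollary2 : (n t : ℕ) → 1 ≤ n → 1 ≤ t →
    (∃[ k ] ((Triples n t (λ ℓ → ℓ ≡ t) ↔ Fin k) × (Schmidt3 n (3 * t) ↔ Fin k)))
    × (∃[ k ] ((Triples n t (λ ℓ → ℓ < t) ↔ Fin k) × (Schmidt3 n (3 * t ∸ 1) ↔ Fin k)))
corollary2 n (suc t) _ _ =
  Schmidt3-equinumerous (Triples-full↔Schmidt3 n (suc t)) , Schmidt3-equinumerous (Triples-short↔Schmidt3 n t)
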